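{- Let $P$ be a labelled logic program over a finite signature $\mathit{At}$ and $I\subseteq\mathit{At}$. Then $I\in\mathit{JM}(P)$ if and only if $I\in\mathit{JM}(P^I)$.
   Context: Fix a finite non-empty set $\mathit{At}$ of propositional atoms. A labelled rule $r$ has the form $\ell : p_1 \vee \dots \vee p_m \leftarrow q_1 \wedge \dots \wedge q_n \wedge \neg s_1 \wedge \dots \wedge \neg s_j \wedge \neg\neg t_1 \wedge \dots \wedge \neg\neg t_k$ with all atoms in $\mathit{At}$ and $m,n,j,k\ge 0$. Its label is $\mathit{Lb}(r)=\ell$, its head $\mathit{Head}(r)$ is $p_1\vee\dots\vee p_m$ with head atoms $H(r)=\{p_1,\dots,p_m\}$, its body $\mathit{Body}(r)$ is the conjunction on the right, its positive body is $\mathit{Body}^+(r)=q_1\wedge\dots\wedge q_n$ with atoms $B^+(r)=\{q_1,\dots,q_n\}$, and its negative body $\mathit{Body}^-(r)$ is the conjunction of the remaining literals; empty disjunction is $\bot$, empty conjunction is $\top$. A labelled program is a set of labelled rules with no repeated label; $\mathit{Lb}(Q)$ is the set of labels of $Q$. An interpretation $I\subseteq\mathit{At}$ is a model of $Q$ if it classically satisfies $\mathit{Body}(r)\to\mathit{Head}(r)$ for every $r\in Q$. The reduct is $P^I=\{\mathit{Lb}(r):\mathit{Head}(r)\leftarrow\mathit{Body}^+(r)\mid r\in P,\ I\models\mathit{Body}^-(r)\}$. $\mathit{Sup}(I,Q,p)=\{r\in Q\mid p\in H(r),\ I\models\mathit{Body}(r)\}$. A support graph of a model $I$ of $Q$ is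 $G=\langle I,E,\lambda\rangle$ with vertices $I$, edges $E\subseteq I\times I$, $\lambda:I\to\mathit{Lb}(Q)$, such that (i) $\lambda$ is injective and (ii) for every $p\in I$ the rule $r\in Q$ with $\mathit{Lb}(r)=\lambda(p)$ satisfies $r\in\mathit{Sup}(I,Q,p)$ and $B^+(r)=\{q\mid(q,p)\in E\}$; an explanation is an acyclic support graph. $\mathit{JM}(Q)$ is the set of models of $Q$ that have at least one explanation under $Q$ (justified models). -}

module Defs where

open import Data.Nat using (ℕ; suc)
open import Data.Fin using (Fin)
open import Data.Bool using (Bool; true; false)
open import Data.List using (List; []; map; filter)
open import Data.List.Membership.Propositional using (_∈_)
open import Data.List.Relation.Unary.All using (All)
open import Data.List.Relation.Unary.Any using (Any)
open import Data.List.Relation.Unary.Unique.Propositional using (Unique)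
open import Data.Product using (Σ; _×_; ∃-syntax)
open import Relation.Binary.PropositionalEquality using (_≡_)
open import Relation.Binary.Construct.Closure.Transitive using (TransClosure)
open import Relation.Nullary using (¬_; Dec)
open import Data.List.Relation.Unary.All using (all?)
open import Data.Bool using (_≟_)
open import Data.Product using (_,_)
open import Relation.Nullary using (_×-dec_)
open import Function.Bundles using (_⇔_)

Label : Set
Label = ℕ

-- A labelled rule over atoms Fin n:
--   label : head₁ ∨ … ← pos₁ ∧ … ∧ ¬neg₁ ∧ … ∧ ¬¬nneg₁ ∧ …
record Rule (n : ℕ) : Set where
  constructor rule
  field
    label : Label
    head  : List (Fin n)
    pos   : List (Fin n)
    neg   : List (Fin n)
    nneg  : List (Fin n)
open Rule public

Program : ℕ → Set
Program n = List (Rule n)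

Labelled : ∀ {n} → Program n → Set
Labelled Q = Unique (map label Q)

Interp : ℕ → Set
Interp n = Fin n → Bool

_∈I_ : ∀ {n} → Fin n → Interp n → Set
p ∈I I = I p ≡ true

SatNegBody : ∀ {n} → Interp n → Rule n → Set
SatNegBody I r = All (λ s → I s ≡ false) (neg r) × All (λ t → I t ≡ true) (nneg r)

SatBody : ∀ {n} → Interp n → Rule n → Set
SatBody I r = All (λ q → I q ≡ true) (pos r) × SatNegBody I r

SatHead : ∀ {n} → Interp n → Rule n → Set
SatHead I r = Any (λ p → I p ≡ true) (head r)

IsModel : ∀ {n} → Interp n → Program n → Set
IsModel I Q = ∀ r → r ∈ Q → SatBody I r → SatHead I r

satNegBody? : ∀ {n} (I : Interp n) (r : Rule n) → Dec (SatNegBody I r)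
satNegBody? I r = all? (λ s → I s ≟ false) (neg r) ×-dec all? (λ t → I t ≟ true) (nneg r)

stripNeg : ∀ {n} → Rule n → Rule n
stripNeg r = rule (label r) (head r) (pos r) [] []

reduct : ∀ {n} → Program n → Interp n → Program n
reduct P I = map stripNeg (filter (satNegBody? I) P)

InSup : ∀ {n} → Interp n → Program n → Fin n → Rule n → Set
InSup I Q p r = r ∈ Q × p ∈ head r × SatBody I r

-- Support graph ⟨I, E, λ⟩ of I under Q.  E is a relation on atoms which
-- must only relate atoms of I; λ is only meaningful on I.
record SupportGraph {n} (I : Interp n) (Q : Program n) : Set₁ where
  field
    E      : Fin n → Fin n → Set
    λ'     : Fin n → Label
    E-in-I : ∀ q p → E q p → q ∈I I × p ∈I I
    λ-inj  : ∀ p p' → p ∈I I → p' ∈I I → λ' p ≡ λ' p' → p ≡ p'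
    supp   : ∀ p → p ∈I I →
             Σ (Rule n) λ r → label r ≡ λ' p × InSup I Q p r ×
               (∀ q → (q ∈ pos r) ⇔ E q p)

Acyclic : ∀ {n} → (Fin n → Fin n → Set) → Set
Acyclic E = ∀ p → ¬ TransClosure E p p

record Explanation {n} (I : Interp n) (Q : Program n) : Set₁ where
  field
    graph   : SupportGraph I Q
    acyclic : Acyclic (SupportGraph.E graph)

JM : ∀ {n} → Program n → Interp n → Set₁
JM Q I = IsModel I Q × Explanation I Q

-- Justification only inspects the rules whose body holds in I, and only their
-- label, head and positive body.  Taking the reduct w.r.t. I keeps exactly the
-- rules whose negative body holds in I and erases that negative body, so the
-- rules active in I correspond one-to-one, with the same label, head and
-- positive body.  Hence models, support graphs and (with the same edges)
-- explanations transfer both ways.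
module Submission where

open import Defs
open import Data.Nat using (ℕ; suc)
open import Data.Product using (Σ; _×_; _,_)
open import Data.List.Relation.Unary.All using ([])
open import Data.List.Membership.Propositional using (_∈_)
open import Data.List.Membership.Propositional.Properties
  using (∈-map⁺; ∈-map⁻; ∈-filter⁺; ∈-filter⁻)
open import Function.Bundles using (_⇔_; mk⇔)
open import Relation.Binary.PropositionalEquality using (_≡_; refl; sym; trans; cong; subst)

module _ {n : ℕ} (I : Interp n) where

  ActiveCopyIn : Program n → Rule n → Set
  ActiveCopyIn Q r = Σ (Rule n) λ r' → r' ∈ Q × SatBody I r' × stripNeg r' ≡ stripNeg r

  Covers : Program n → Program n → Set
  Covers Q Q' = ∀ r → r ∈ Q → SatBody I r → ActiveCopyIn Q' r

  isModel-covered : ∀ {Q Q'} → Covers Q Q' → IsModel I Q' → IsModel I Q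
  isModel-covered cov M r r∈Q body with cov r r∈Q body
  ... | r' , r'∈Q' , body' , same = subst (SatHead I) same (M r' r'∈Q' body')

  supportGraph-covered : ∀ {Q Q'} → Covers Q Q' → SupportGraph I Q → SupportGraph I Q'
  supportGraph-covered {Q} {Q'} cov G = record
    { E = E ; λ' = λ' ; E-in-I = E-in-I ; λ-inj = λ-inj ; supp = supp' }
    where
    open SupportGraph G
    supp' : ∀ p → p ∈I I → Σ (Rule n) λ r' → label r' ≡ λ' p × InSup I Q' p r' ×
              (∀ q → (q ∈ pos r') ⇔ E q p)
    supp' p p∈I with supp p p∈I
    ... | r , lbl , (r∈Q , p∈head , body) , edges with cov r r∈Q body
    ... | r' , r'∈Q' , body' , same =
      r' , trans (cong label same) lbl
         , (r'∈Q' , subst (p ∈_) (sym (cong head same)) p∈head , body')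
         , subst (λ ps → ∀ q → (q ∈ ps) ⇔ E q p) (sym (cong pos same)) edges

  explanation-covered : ∀ {Q Q'} → Covers Q Q' → Explanation I Q → Explanation I Q'
  explanation-covered cov X = record
    { graph = supportGraph-covered cov (Explanation.graph X) ; acyclic = Explanation.acyclic X }

  JM-covered⇔ : ∀ {Q Q'} → Covers Q Q' → Covers Q' Q → JM Q I ⇔ JM Q' I
  JM-covered⇔ cov cov' = mk⇔
    (λ (M , X) → isModel-covered cov' M , explanation-covered cov X)
    (λ (M , X) → isModel-covered cov M , explanation-covered cov' X)

  module _ (P : Program n) where

    ∈-reduct⁻ : ∀ {r'} → r' ∈ reduct P I →
                Σ (Rule n) λ r → r ∈ P × SatNegBody I r × r' ≡ stripNeg r
    ∈-reduct⁻ r'∈ with ∈-map⁻ stripNeg r'∈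
    ... | r , r∈filter , refl with ∈-filter⁻ (satNegBody? I) r∈filter
    ... | r∈P , neg = r , r∈P , neg , refl

    ∈-reduct⁺ : ∀ {r} → r ∈ P → SatNegBody I r → stripNeg r ∈ reduct P I
    ∈-reduct⁺ r∈P neg = ∈-map⁺ stripNeg (∈-filter⁺ (satNegBody? I) r∈P neg)

    program-covers-reduct : Covers P (reduct P I)
    program-covers-reduct r r∈P (posBody , negBody) =
      stripNeg r , ∈-reduct⁺ r∈P negBody , (posBody , [] , []) , refl

    reduct-covers-program : Covers (reduct P I) P
    reduct-covers-program r' r'∈ (posBody , _) with ∈-reduct⁻ r'∈
    ... | r , r∈P , negBody , refl = r , r∈P , (posBody , negBody) , refl

corollary1 : ∀ {n} (P : Program (suc n)) → Labelled P → (I : Interp (suc n)) →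
    JM P I ⇔ JM (reduct P I) I
corollary1 P _ I = JM-covered⇔ I (program-covers-reduct I P) (reduct-covers-program I P)
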